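{- For every positive integer $s$, $d_4(21s,3)=16s-1$.
   Context: $\mathbb{F}_4=\{0,1,\omega,\omega^2\}$ with $\omega^2=\omega+1$, $\overline{x}=x^2$. A quaternary $[n,k]$ code is a $k$-dimensional subspace of $\mathbb{F}_4^n$; its minimum weight is its minimum nonzero Hamming weight. The Hermitian dual is $C^{\perp_H}=\{x : \sum_i x_i\overline{y_i}=0\ \forall y\in C\}$, and $C$ is Hermitian LCD if $C\cap C^{\perp_H}=\{0\}$. $d_4(n,k)$ is the largest minimum weight among all quaternary Hermitian LCD $[n,k]$ codes. -}

module Defs where

open import Data.Nat using (ℕ; zero; suc; _≤_)
open import Data.Vec using (Vec; []; _∷_; zipWith; replicate; map; foldr)
open import Data.Product using (Σ; ∃; _×_; _,_)
open import Relation.Binary.PropositionalEquality using (_≡_; _≢_)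
open import Relation.Nullary using (¬_)

-- The field F4 = {0, 1, ω, ω²} with ω² = ω + 1 (characteristic 2).
data F4 : Set where
  𝟎 𝟏 ω ω² : F4

infixl 6 _⊕_
infixl 7 _⊗_

_⊕_ : F4 → F4 → F4
𝟎  ⊕ y  = y
x  ⊕ 𝟎  = x
𝟏  ⊕ 𝟏  = 𝟎
𝟏  ⊕ ω  = ω²
𝟏  ⊕ ω² = ω
ω  ⊕ 𝟏  = ω²
ω  ⊕ ω  = 𝟎
ω  ⊕ ω² = 𝟏
ω² ⊕ 𝟏  = ω
ω² ⊕ ω  = 𝟏
ω² ⊕ ω² = 𝟎

_⊗_ : F4 → F4 → F4
𝟎  ⊗ y  = 𝟎
x  ⊗ 𝟎  = 𝟎
𝟏  ⊗ y  = y
x  ⊗ 𝟏  = x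
ω  ⊗ ω  = ω²
ω  ⊗ ω² = 𝟏
ω² ⊗ ω  = 𝟏
ω² ⊗ ω² = ω

conj : F4 → F4
conj x = x ⊗ x

Word : ℕ → Set
Word n = Vec F4 n

zeroWord : ∀ {n} → Word n
zeroWord = replicate _ 𝟎

_+ᵥ_ : ∀ {n} → Word n → Word n → Word n
_+ᵥ_ = zipWith _⊕_

_·ᵥ_ : ∀ {n} → F4 → Word n → Word n
a ·ᵥ v = map (a ⊗_) v

herm : ∀ {n} → Word n → Word n → F4
herm x y = foldr _ _⊕_ 𝟎 (zipWith (λ a b → a ⊗ conj b) x y)

wt : ∀ {n} → Word n → ℕ
wt [] = 0
wt (𝟎 ∷ v) = wt v
wt (𝟏 ∷ v) = suc (wt v)
wt (ω ∷ v) = suc (wt v)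
wt (ω² ∷ v) = suc (wt v)

Gen : ℕ → ℕ → Set
Gen n k = Vec (Word n) k

lincomb : ∀ {n k} → Vec F4 k → Gen n k → Word n
lincomb [] [] = zeroWord
lincomb (c ∷ cs) (g ∷ gs) = (c ·ᵥ g) +ᵥ lincomb cs gs

_∈C_ : ∀ {n k} → Word n → Gen n k → Set
x ∈C G = ∃ λ c → lincomb c G ≡ x

-- The rows of G are linearly independent, so C has dimension exactly k;
-- thus (G independent) ↔ C is a quaternary [n,k] code.
Independent : ∀ {n k} → Gen n k → Set
Independent G = ∀ c → lincomb c G ≡ zeroWord → c ≡ zeroWord

HermLCD : ∀ {n k} → Gen n k → Set
HermLCD G = ∀ x → x ∈C G → (∀ y → y ∈C G → herm x y ≡ 𝟎) → x ≡ zeroWord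

MinWeight : ∀ {n k} → Gen n k → ℕ → Set
MinWeight G d =
  (Σ _ λ x → x ∈C G × x ≢ zeroWord × wt x ≡ d) ×
  (∀ x → x ∈C G → x ≢ zeroWord → d ≤ wt x)

-- d₄(n,k) = d : d is the largest minimum weight among all quaternary
-- Hermitian LCD [n,k] codes (attained, and an upper bound).
D4 : ℕ → ℕ → ℕ → Set
D4 n k d =
  (Σ (Gen n k) λ G → Independent G × HermLCD G × MinWeight G d) ×
  (∀ (G : Gen n k) → Independent G → HermLCD G → ∀ d' → MinWeight G d' → d' ≤ d)

-- The weight of the codeword cG is the number of columns of G not orthogonal to
-- c, and its Hermitian product with eG is the sum over the columns x of
-- (c·x) conj(e·x); both only depend on how many columns span each of the 21
-- points of PG(2,4).  Suppose a Hermitian LCD [21s,3] code had minimum weight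
-- at least 16s.  A nonzero column is orthogonal to exactly 5 of the 21 points,
-- so summing the weights of the 21 codewords cG (c a point) gives 16 times the
-- number of nonzero columns, at most 16·21s: every such weight is exactly 16s
-- and no column vanishes.  Summing instead over the 5 points orthogonal to a
-- point p shows that exactly s columns span p.  So the code is s copies of the
-- simplex code, which is Hermitian self-orthogonal: contradiction.
-- Conversely, a Hermitian LCD [21,3,15] code juxtaposed with s-1 copies of the
-- simplex code (one-weight 16, self-orthogonal) is Hermitian LCD of minimum
-- weight 15 + 16(s-1).

module Submission where

open import Algebra.Bundles using (CommutativeMonoid)
open import Algebra.Core using (Op₂)
open import Algebra.Structures using (IsCommutativeMonoid)
open import Data.Bool using (if_then_else_)
open import Data.Empty using (⊥-elim)
open import Data.Nat as ℕ using (ℕ; zero; suc; _+_; _*_; _∸_; _≤_; z≤n; s≤s; _≤?_)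
open import Data.Nat.Properties
  using ( +-0-isCommutativeMonoid; *-zeroʳ; *-assoc; *-distribˡ-+; *-distribʳ-+; +-comm
        ; +-mono-≤; +-monoˡ-≤; +-monoʳ-≤; *-monoʳ-≤; +-cancelˡ-≤; +-cancelʳ-≤; +-cancelˡ-≡
        ; *-cancelˡ-≡; *-cancelˡ-≤; ≤-trans; ≤-antisym; ≰⇒>; <⇒≤pred; 1+n≰n
        ; pred[m∸n]≡m∸[1+n]; module ≤-Reasoning )
open import Data.Nat.Tactic.RingSolver using (solve-∀)
open import Data.Product using (∃; _,_; proj₁; proj₂) renaming (_×_ to _∧_)
open import Data.Vec using (Vec; []; _∷_; _++_; map; zipWith; foldr; replicate; concat; transpose; _⊛_; sum)
open import Data.Vec.Properties using (≡-dec; map-cong; map-∘; map-++; map-replicate; map-const)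
open import Data.Vec.Relation.Unary.All as All using (All; []; _∷_; all?)
open import Data.Vec.Relation.Unary.All.Properties using (map⁺; map⁻)
open import Function using (_∘_)
open import Level using (0ℓ)
open import Relation.Binary.Definitions using (DecidableEquality)
open import Relation.Binary.PropositionalEquality
open import Relation.Nullary using (Dec; yes; no; does; ¬?; map′; _×-dec_; _→-dec_)
open import Relation.Nullary.Decidable using (from-yes)
open import Relation.Unary using (Universal; Satisfiable) renaming (Decidable to Decidable₁)

open import Defs

infix 4 _≟_ _≟ᵛ_

_≟_ : DecidableEquality F4
𝟎  ≟ 𝟎  = yes refl
𝟏  ≟ 𝟏  = yes refl
ω  ≟ ω  = yes refl
ω² ≟ ω² = yes refl
𝟎  ≟ 𝟏  = no λ ()
𝟎  ≟ ω  = no λ ()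
𝟎  ≟ ω² = no λ ()
𝟏  ≟ 𝟎  = no λ ()
𝟏  ≟ ω  = no λ ()
𝟏  ≟ ω² = no λ ()
ω  ≟ 𝟎  = no λ ()
ω  ≟ 𝟏  = no λ ()
ω  ≟ ω² = no λ ()
ω² ≟ 𝟎  = no λ ()
ω² ≟ 𝟏  = no λ ()
ω² ≟ ω  = no λ ()

_≟ᵛ_ : ∀ {n} → DecidableEquality (Word n)
_≟ᵛ_ = ≡-dec _≟_

universal? : {P : F4 → Set} → Decidable₁ P → Dec (Universal P)
universal? P? with P? 𝟎 | P? 𝟏 | P? ω | P? ω²
... | yes p₀ | yes p₁ | yes p₂ | yes p₃ = yes λ { 𝟎 → p₀ ; 𝟏 → p₁ ; ω → p₂ ; ω² → p₃ }
... | no ¬p  | _     | _     | _      = no λ h → ¬p (h 𝟎)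
... | yes _  | no ¬p | _     | _      = no λ h → ¬p (h 𝟏)
... | yes _  | yes _ | no ¬p | _      = no λ h → ¬p (h ω)
... | yes _  | yes _ | yes _ | no ¬p  = no λ h → ¬p (h ω²)

satisfiable? : {P : F4 → Set} → Decidable₁ P → Dec (Satisfiable P)
satisfiable? P? with P? 𝟎 | P? 𝟏 | P? ω | P? ω²
... | yes p | _     | _     | _     = yes (𝟎 , p)
... | no _  | yes p | _     | _     = yes (𝟏 , p)
... | no _  | no _  | yes p | _     = yes (ω , p)
... | no _  | no _  | no _  | yes p = yes (ω² , p)
... | no ¬p₀ | no ¬p₁ | no ¬p₂ | no ¬p₃ =
  no λ { (𝟎 , p) → ¬p₀ p ; (𝟏 , p) → ¬p₁ p ; (ω , p) → ¬p₂ p ; (ω² , p) → ¬p₃ p }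

universalᵛ? : ∀ {n} {P : Word n → Set} → Decidable₁ P → Dec (Universal P)
universalᵛ? {zero}  P? = map′ (λ { p [] → p }) (λ h → h []) (P? [])
universalᵛ? {suc n} P? =
  map′ (λ { h (x ∷ xs) → h x xs }) (λ h x xs → h (x ∷ xs))
       (universal? λ x → universalᵛ? λ xs → P? (x ∷ xs))

⊕-𝟎-isCommutativeMonoid : IsCommutativeMonoid _≡_ _⊕_ 𝟎
⊕-𝟎-isCommutativeMonoid = record
  { isMonoid = record
    { isSemigroup = record
      { isMagma = record { isEquivalence = isEquivalence ; ∙-cong = cong₂ _⊕_ }
      ; assoc = from-yes (universal? λ a → universal? λ b → universal? λ c → (a ⊕ b) ⊕ c ≟ a ⊕ (b ⊕ c))
      }
    ; identity = (λ _ → refl) , from-yes (universal? λ a → a ⊕ 𝟎 ≟ a)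
    }
  ; comm = from-yes (universal? λ a → universal? λ b → a ⊕ b ≟ b ⊕ a)
  }

⊗-comm : ∀ a b → a ⊗ b ≡ b ⊗ a
⊗-comm = from-yes (universal? λ a → universal? λ b → a ⊗ b ≟ b ⊗ a)

⊗-zeroʳ : ∀ a → a ⊗ 𝟎 ≡ 𝟎
⊗-zeroʳ = from-yes (universal? λ a → a ⊗ 𝟎 ≟ 𝟎)

⊗-distribˡ-⊕ : ∀ u a b → u ⊗ (a ⊕ b) ≡ u ⊗ a ⊕ u ⊗ b
⊗-distribˡ-⊕ = from-yes (universal? λ u → universal? λ a → universal? λ b → u ⊗ (a ⊕ b) ≟ u ⊗ a ⊕ u ⊗ b)

⊗-leftComm : ∀ a u b → a ⊗ (u ⊗ b) ≡ u ⊗ (a ⊗ b)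
⊗-leftComm = from-yes (universal? λ a → universal? λ u → universal? λ b → a ⊗ (u ⊗ b) ≟ u ⊗ (a ⊗ b))

-- u ū = u³ = 1 for every nonzero u.
⊗-conj-unit : ∀ u a b → u ≢ 𝟎 → (u ⊗ a) ⊗ conj (u ⊗ b) ≡ a ⊗ conj b
⊗-conj-unit = from-yes (universal? λ u → universal? λ a → universal? λ b →
  ¬? (u ≟ 𝟎) →-dec (u ⊗ a) ⊗ conj (u ⊗ b) ≟ a ⊗ conj b)

-- Interleaving, rather than bs ++ t copies of ps, makes the length n * suc t
-- definitionally.
juxtapose : ∀ {B : Set} {n} t → Vec B n → Vec B n → Vec B (n * suc t)
juxtapose t bs ps = concat (zipWith (λ b p → b ∷ replicate t p) bs ps)

module Sum {A : Set} {_∙_ : Op₂ A} {ε : A} (isCM : IsCommutativeMonoid _≡_ _∙_ ε) where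

  open IsCommutativeMonoid isCM using (assoc; identityˡ)

  commutativeMonoid : CommutativeMonoid 0ℓ 0ℓ
  commutativeMonoid = record { isCommutativeMonoid = isCM }

  open import Algebra.Properties.CommutativeMonoid.Mult commutativeMonoid
    public using (_×_; ×-homo-+; ×-distrib-+)
  open import Algebra.Properties.CommutativeSemigroup (CommutativeMonoid.commutativeSemigroup commutativeMonoid)
    using (interchange; x∙yz≈y∙xz)
  open ≡-Reasoning

  ∑ : ∀ {n} → Vec A n → A
  ∑ = foldr _ _∙_ ε

  ×-zeroʳ : ∀ n → n × ε ≡ ε
  ×-zeroʳ zero    = refl
  ×-zeroʳ (suc n) = trans (identityˡ (n × ε)) (×-zeroʳ n)

  ∑-++ : ∀ {m n} (xs : Vec A m) (ys : Vec A n) → ∑ (xs ++ ys) ≡ (∑ xs ∙ ∑ ys)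
  ∑-++ []       ys = sym (identityˡ (∑ ys))
  ∑-++ (x ∷ xs) ys = trans (cong (x ∙_) (∑-++ xs ys)) (sym (assoc x (∑ xs) (∑ ys)))

  ∑-replicate : ∀ n x → ∑ (replicate n x) ≡ n × x
  ∑-replicate zero    x = refl
  ∑-replicate (suc n) x = cong (x ∙_) (∑-replicate n x)

  module _ {B : Set} where

    ∑-map-∙ : ∀ {n} (f g : B → A) (xs : Vec B n) →
              ∑ (map (λ x → f x ∙ g x) xs) ≡ ∑ (map f xs) ∙ ∑ (map g xs)
    ∑-map-∙ f g []       = sym (identityˡ ε)
    ∑-map-∙ f g (x ∷ xs) = trans (cong ((f x ∙ g x) ∙_) (∑-map-∙ f g xs))
                                 (interchange (f x) (g x) (∑ (map f xs)) (∑ (map g xs)))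

    ∑-map-ε : ∀ {n} (xs : Vec B n) → ∑ (map (λ _ → ε) xs) ≡ ε
    ∑-map-ε []       = refl
    ∑-map-ε (x ∷ xs) = trans (identityˡ _) (∑-map-ε xs)

    ∑-map-×ˡ : ∀ {n} t (f : B → A) (xs : Vec B n) → ∑ (map (λ x → t × f x) xs) ≡ t × ∑ (map f xs)
    ∑-map-×ˡ t f []       = sym (×-zeroʳ t)
    ∑-map-×ˡ t f (x ∷ xs) = trans (cong ((t × f x) ∙_) (∑-map-×ˡ t f xs))
                                  (sym (×-distrib-+ (f x) (∑ (map f xs)) t))

    ∑-map-congᴬ : ∀ {n} {f g : B → A} {xs : Vec B n} → All (λ x → f x ≡ g x) xs → ∑ (map f xs) ≡ ∑ (map g xs)
    ∑-map-congᴬ []         = refl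
    ∑-map-congᴬ (eq ∷ eqs) = cong₂ _∙_ eq (∑-map-congᴬ eqs)

    ∑-map-×-const : ∀ {n} (m : B → ℕ) (f : B → A) v → (∀ x → m x ≢ 0 → f x ≡ v) →
                    (xs : Vec B n) → ∑ (map (λ x → m x × f x) xs) ≡ sum (map m xs) × v
    ∑-map-×-const m f v f≡v []       = refl
    ∑-map-×-const m f v f≡v (x ∷ xs) = begin
      (m x × f x) ∙ ∑ (map (λ x → m x × f x) xs)
        ≡⟨ cong₂ _∙_ (scaled (m x) (f≡v x)) (∑-map-×-const m f v f≡v xs) ⟩
      (m x × v) ∙ (sum (map m xs) × v)
        ≡⟨ ×-homo-+ v (m x) _ ⟨
      sum (map m (x ∷ xs)) × v ∎
      where
      scaled : ∀ k → (k ≢ 0 → f x ≡ v) → k × f x ≡ k × v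
      scaled zero    _   = refl
      scaled (suc k) f≡v = cong (suc k ×_) (f≡v λ ())

  module _ {B C : Set} where

    ∑-map-swap : ∀ {m n} (f : B → C → A) (xs : Vec B m) (ys : Vec C n) →
                 ∑ (map (λ x → ∑ (map (f x) ys)) xs) ≡ ∑ (map (λ y → ∑ (map (λ x → f x y) xs)) ys)
    ∑-map-swap f []       ys = sym (∑-map-ε ys)
    ∑-map-swap f (x ∷ xs) ys = trans (cong (∑ (map (f x) ys) ∙_) (∑-map-swap f xs ys))
                                     (sym (∑-map-∙ (f x) (λ y → ∑ (map (λ x → f x y) xs)) ys))

  ∑-map-juxtapose : ∀ {B : Set} {n} (f : B → A) t (bs ps : Vec B n) →
                    ∑ (map f (juxtapose t bs ps)) ≡ ∑ (map f bs) ∙ (t × ∑ (map f ps))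
  ∑-map-juxtapose f t []       []       = sym (trans (identityˡ (t × ε)) (×-zeroʳ t))
  ∑-map-juxtapose f t (b ∷ bs) (p ∷ ps) = trans (cong (f b ∙_) (begin
    ∑ (map f (replicate t p ++ rest))                   ≡⟨ cong ∑ (map-++ f (replicate t p) rest) ⟩
    ∑ (map f (replicate t p) ++ map f rest)             ≡⟨ ∑-++ (map f (replicate t p)) (map f rest) ⟩
    ∑ (map f (replicate t p)) ∙ ∑ (map f rest)          ≡⟨ cong₂ _∙_ (trans (cong ∑ (map-replicate f p t)) (∑-replicate t (f p)))
                                                                     (∑-map-juxtapose f t bs ps) ⟩
    (t × f p) ∙ (∑ (map f bs) ∙ (t × ∑ (map f ps)))     ≡⟨ x∙yz≈y∙xz (t × f p) (∑ (map f bs)) (t × ∑ (map f ps)) ⟩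
    ∑ (map f bs) ∙ ((t × f p) ∙ (t × ∑ (map f ps)))     ≡⟨ cong (∑ (map f bs) ∙_) (×-distrib-+ (f p) (∑ (map f ps)) t) ⟨
    ∑ (map f bs) ∙ (t × (f p ∙ ∑ (map f ps)))           ∎))
    (sym (assoc (f b) (∑ (map f bs)) _))
    where rest = juxtapose t bs ps

open Sum ⊕-𝟎-isCommutativeMonoid
open IsCommutativeMonoid ⊕-𝟎-isCommutativeMonoid using (identityʳ)
module ℕ-Sum = Sum +-0-isCommutativeMonoid

module _ {B : Set} where

  sum-map-*ˡ : ∀ {n} k (f : B → ℕ) (xs : Vec B n) → sum (map (λ x → k * f x) xs) ≡ k * sum (map f xs)
  sum-map-*ˡ k f []       = sym (*-zeroʳ k)
  sum-map-*ˡ k f (x ∷ xs) = trans (cong (k * f x +_) (sum-map-*ˡ k f xs)) (sym (*-distribˡ-+ k (f x) _))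

  sum-map-*ʳ : ∀ {n} k (f : B → ℕ) (xs : Vec B n) → sum (map (λ x → f x * k) xs) ≡ sum (map f xs) * k
  sum-map-*ʳ k f []       = refl
  sum-map-*ʳ k f (x ∷ xs) = trans (cong (f x * k +_) (sum-map-*ʳ k f xs)) (sym (*-distribʳ-+ k (f x) _))

  sum-map-≤1 : ∀ {n} {f : B → ℕ} → (∀ x → f x ≤ 1) → (xs : Vec B n) → sum (map f xs) ≤ n
  sum-map-≤1 f≤1 []       = z≤n
  sum-map-≤1 f≤1 (x ∷ xs) = +-mono-≤ (f≤1 x) (sum-map-≤1 f≤1 xs)

sum-≥ : ∀ {n b} {ws : Vec ℕ n} → All (b ≤_) ws → n * b ≤ sum ws
sum-≥ []          = z≤n
sum-≥ (b≤w ∷ b≤ws) = +-mono-≤ b≤w (sum-≥ b≤ws)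

sum-≤⇒all-≡ : ∀ {n b} {ws : Vec ℕ n} → All (b ≤_) ws → sum ws ≤ n * b → All (_≡ b) ws
sum-≤⇒all-≡                       []           _  = []
sum-≤⇒all-≡ {suc n} {b} {w ∷ ws} (b≤w ∷ b≤ws) Σ≤ = ≤-antisym w≤b b≤w ∷ sum-≤⇒all-≡ b≤ws Σws≤
  where
  w≤b : w ≤ b
  w≤b = +-cancelʳ-≤ (n * b) w b (≤-trans (+-monoʳ-≤ w (sum-≥ b≤ws)) Σ≤)
  Σws≤ : sum ws ≤ n * b
  Σws≤ = +-cancelˡ-≤ b (sum ws) (n * b) (≤-trans (+-monoˡ-≤ (sum ws) b≤w) Σ≤)

×≡* : ∀ m n → m ℕ-Sum.× n ≡ m * n
×≡* zero    n = refl
×≡* (suc m) n = cong (n +_) (×≡* m n)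

infix 7 _·_

_·_ : ∀ {k} → Word k → Word k → F4
c · x = ∑ (zipWith _⊗_ c x)

·-comm : ∀ {k} (c x : Word k) → c · x ≡ x · c
·-comm []      []      = refl
·-comm (a ∷ c) (y ∷ x) = cong₂ _⊕_ (⊗-comm a y) (·-comm c x)

·-zeroˡ : ∀ {k} (x : Word k) → zeroWord · x ≡ 𝟎
·-zeroˡ []      = refl
·-zeroˡ (_ ∷ x) = ·-zeroˡ x

·-zeroʳ : ∀ {k} (c : Word k) → c · zeroWord ≡ 𝟎
·-zeroʳ c = trans (·-comm c zeroWord) (·-zeroˡ c)

·-scaleʳ : ∀ {k} u (c x : Word k) → c · (u ·ᵥ x) ≡ u ⊗ (c · x)
·-scaleʳ u []      []      = sym (⊗-zeroʳ u)
·-scaleʳ u (a ∷ c) (y ∷ x) = begin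
  a ⊗ (u ⊗ y) ⊕ c · (u ·ᵥ x)  ≡⟨ cong₂ _⊕_ (⊗-leftComm a u y) (·-scaleʳ u c x) ⟩
  u ⊗ (a ⊗ y) ⊕ u ⊗ (c · x)   ≡⟨ ⊗-distribˡ-⊕ u (a ⊗ y) (c · x) ⟨
  u ⊗ (a ⊗ y ⊕ c · x)         ∎
  where open ≡-Reasoning

module _ {A : Set} where

  transpose-∷ : ∀ {k n} (x : Vec A k) (xs : Vec (Vec A n) k) →
                transpose (replicate k _∷_ ⊛ x ⊛ xs) ≡ x ∷ transpose xs
  transpose-∷ []      []       = refl
  transpose-∷ (a ∷ x) (y ∷ xs) = cong (λ ys → replicate _ _∷_ ⊛ (a ∷ y) ⊛ ys) (transpose-∷ x xs)

  transpose-involutive : ∀ {k n} (xs : Vec (Vec A k) n) → transpose (transpose xs) ≡ xs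
  transpose-involutive []       = Vec₀ (transpose (transpose []))
    where
    Vec₀ : ∀ {B : Set} (v : Vec B 0) → v ≡ []
    Vec₀ [] = refl
  transpose-involutive (x ∷ xs) = trans (transpose-∷ x (transpose xs)) (cong (x ∷_) (transpose-involutive xs))

lincomb-transpose : ∀ {n k} (c : Word k) (G : Gen n k) → lincomb c G ≡ map (c ·_) (transpose G)
lincomb-transpose {n} []      []      = sym (map-replicate ([] ·_) [] n)
lincomb-transpose     (a ∷ c) (g ∷ G) =
  trans (cong ((a ·ᵥ g) +ᵥ_) (lincomb-transpose c G)) (columnwise g (transpose G))
  where
  columnwise : ∀ {n} (g : Word n) (xs : Vec (Word _) n) →
               (a ·ᵥ g) +ᵥ map (c ·_) xs ≡ map ((a ∷ c) ·_) (replicate n _∷_ ⊛ g ⊛ xs)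
  columnwise []      []       = refl
  columnwise (y ∷ g) (x ∷ xs) = cong (a ⊗ y ⊕ c · x ∷_) (columnwise g xs)

lincomb-zero : ∀ {n k} (G : Gen n k) → lincomb zeroWord G ≡ zeroWord
lincomb-zero G = trans (lincomb-transpose zeroWord G)
                       (trans (map-cong ·-zeroˡ (transpose G)) (map-const (transpose G) 𝟎))

wt₁ : F4 → ℕ
wt₁ 𝟎 = 0
wt₁ _ = 1

wt≡sum : ∀ {n} (x : Word n) → wt x ≡ sum (map wt₁ x)
wt≡sum []       = refl
wt≡sum (𝟎 ∷ x)  = wt≡sum x
wt≡sum (𝟏 ∷ x)  = cong suc (wt≡sum x)
wt≡sum (ω ∷ x)  = cong suc (wt≡sum x)
wt≡sum (ω² ∷ x) = cong suc (wt≡sum x)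

weight : ∀ {n k} → Word k → Vec (Word k) n → ℕ
weight c xs = sum (map (λ x → wt₁ (c · x)) xs)

wt-lincomb : ∀ {n k} (c : Word k) (G : Gen n k) → wt (lincomb c G) ≡ weight c (transpose G)
wt-lincomb c G = begin
  wt (lincomb c G)                          ≡⟨ cong wt (lincomb-transpose c G) ⟩
  wt (map (c ·_) (transpose G))             ≡⟨ wt≡sum (map (c ·_) (transpose G)) ⟩
  sum (map wt₁ (map (c ·_) (transpose G)))  ≡⟨ cong sum (map-∘ wt₁ (c ·_) (transpose G)) ⟨
  weight c (transpose G)                    ∎
  where open ≡-Reasoning

wt-zeroWord : ∀ n → wt (zeroWord {n}) ≡ 0
wt-zeroWord zero    = refl
wt-zeroWord (suc n) = wt-zeroWord n

hermAt : ∀ {k} → Word k → Word k → Word k → F4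
hermAt c e x = (c · x) ⊗ conj (e · x)

herm-lincomb : ∀ {n k} (c e : Word k) (G : Gen n k) →
               herm (lincomb c G) (lincomb e G) ≡ ∑ (map (hermAt c e) (transpose G))
herm-lincomb c e G rewrite lincomb-transpose c G | lincomb-transpose e G = columnwise (transpose G)
  where
  columnwise : ∀ {n} (xs : Vec (Word _) n) → herm (map (c ·_) xs) (map (e ·_) xs) ≡ ∑ (map (hermAt c e) xs)
  columnwise []       = refl
  columnwise (x ∷ xs) = cong (hermAt c e x ⊕_) (columnwise xs)

infix 4 _∼_ _∼?_

_∼_ : ∀ {k} → Word k → Word k → Set
x ∼ p = ∃ λ u → u ≢ 𝟎 ∧ x ≡ u ·ᵥ p

_∼?_ : ∀ {k} (x p : Word k) → Dec (x ∼ p)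
x ∼? p = satisfiable? λ u → ¬? (u ≟ 𝟎) ×-dec x ≟ᵛ u ·ᵥ p

hermAt-∼ : ∀ {k} (c e : Word k) {x p} → x ∼ p → hermAt c e x ≡ hermAt c e p
hermAt-∼ c e {p = p} (u , u≢𝟎 , refl) =
  trans (cong₂ (λ a b → a ⊗ conj b) (·-scaleʳ u c p) (·-scaleʳ u e p)) (⊗-conj-unit u (c · p) (e · p) u≢𝟎)

𝕀 : {P : Set} → Dec P → ℕ
𝕀 d = if does d then 1 else 0

𝕀≤1 : {P : Set} (d : Dec P) → 𝕀 d ≤ 1
𝕀≤1 (yes _) = s≤s z≤n
𝕀≤1 (no  _) = z≤n

nonzero : ∀ {k} → Word k → ℕ
nonzero x = 𝕀 (¬? (x ≟ᵛ zeroWord))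

nonzero-≢ : ∀ {k} {x : Word k} → x ≢ zeroWord → nonzero x ≡ 1
nonzero-≢ {x = x} x≢0 with x ≟ᵛ zeroWord
... | yes x≡0 = ⊥-elim (x≢0 x≡0)
... | no  _   = refl

Point : Set
Point = Word 3

-- The 21 points of PG(2,4), each normalised to have first nonzero coordinate 𝟏;
-- as columns they generate the simplex code.
points : Vec Point 21
points =
  (𝟎 ∷ 𝟎 ∷ 𝟏 ∷ []) ∷ (𝟎 ∷ 𝟏 ∷ 𝟎 ∷ []) ∷ (𝟎 ∷ 𝟏 ∷ 𝟏 ∷ []) ∷ (𝟎 ∷ 𝟏 ∷ ω ∷ []) ∷ (𝟎 ∷ 𝟏 ∷ ω² ∷ []) ∷
  (𝟏 ∷ 𝟎 ∷ 𝟎 ∷ []) ∷ (𝟏 ∷ 𝟎 ∷ 𝟏 ∷ []) ∷ (𝟏 ∷ 𝟎 ∷ ω ∷ []) ∷ (𝟏 ∷ 𝟎 ∷ ω² ∷ []) ∷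
  (𝟏 ∷ 𝟏 ∷ 𝟎 ∷ []) ∷ (𝟏 ∷ 𝟏 ∷ 𝟏 ∷ []) ∷ (𝟏 ∷ 𝟏 ∷ ω ∷ []) ∷ (𝟏 ∷ 𝟏 ∷ ω² ∷ []) ∷
  (𝟏 ∷ ω ∷ 𝟎 ∷ []) ∷ (𝟏 ∷ ω ∷ 𝟏 ∷ []) ∷ (𝟏 ∷ ω ∷ ω ∷ []) ∷ (𝟏 ∷ ω ∷ ω² ∷ []) ∷
  (𝟏 ∷ ω² ∷ 𝟎 ∷ []) ∷ (𝟏 ∷ ω² ∷ 𝟏 ∷ []) ∷ (𝟏 ∷ ω² ∷ ω ∷ []) ∷ (𝟏 ∷ ω² ∷ ω² ∷ []) ∷ []

orthogonal : Point → Point → ℕ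
orthogonal c p = 𝕀 (c · p ≟ 𝟎)

points-nonzero : All (_≢ zeroWord) points
points-nonzero = from-yes (all? (λ p → ¬? (p ≟ᵛ zeroWord)) points)

points-partition : ∀ x → sum (map (λ p → 𝕀 (x ∼? p)) points) ≡ nonzero x
points-partition = from-yes (universalᵛ? λ x → sum (map (λ p → 𝕀 (x ∼? p)) points) ℕ.≟ nonzero x)

-- A nonzero c is orthogonal to exactly the 5 points of the line c^⊥.
simplex-weight : ∀ c → weight c points ≡ 16 * nonzero c
simplex-weight = from-yes (universalᵛ? λ c → weight c points ℕ.≟ 16 * nonzero c)

simplex-self-orthogonal : ∀ c e → ∑ (map (hermAt c e) points) ≡ 𝟎
simplex-self-orthogonal = from-yes (universalᵛ? λ c → universalᵛ? λ e → ∑ (map (hermAt c e) points) ≟ 𝟎)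

pencil-size : All (λ p → sum (map (λ c → orthogonal c p) points) ≡ 5) points
pencil-size = from-yes (all? (λ p → sum (map (λ c → orthogonal c p) points) ℕ.≟ 5) points)

-- The 5 points c ⊥ p are all orthogonal to an x spanning p, but exactly one of
-- them (the normal of the line through p and x) to any other nonzero x.
pencil-weight : All (λ p → ∀ x → sum (map (λ c → orthogonal c p * wt₁ (c · x)) points) + 4 * 𝕀 (x ∼? p)
                                 ≡ 4 * nonzero x) points
pencil-weight = from-yes (all? (λ p → universalᵛ? λ x →
  sum (map (λ c → orthogonal c p * wt₁ (c · x)) points) + 4 * 𝕀 (x ∼? p) ℕ.≟ 4 * nonzero x) points)

hermAt-by-points : ∀ (c e x : Point) → ∑ (map (λ p → 𝕀 (x ∼? p) × hermAt c e p) points) ≡ hermAt c e x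
hermAt-by-points c e x = begin
  ∑ (map (λ p → 𝕀 (x ∼? p) × hermAt c e p) points)
    ≡⟨ ∑-map-×-const (λ p → 𝕀 (x ∼? p)) (hermAt c e) (hermAt c e x) on-x points ⟩
  sum (map (λ p → 𝕀 (x ∼? p)) points) × hermAt c e x
    ≡⟨ cong (_× hermAt c e x) (points-partition x) ⟩
  nonzero x × hermAt c e x
    ≡⟨ nonzero-× ⟩
  hermAt c e x ∎
  where
  open ≡-Reasoning
  on-x : ∀ p → 𝕀 (x ∼? p) ≢ 0 → hermAt c e p ≡ hermAt c e x
  on-x p 𝕀≢0 with x ∼? p
  ... | yes x∼p = sym (hermAt-∼ c e x∼p)
  ... | no  _   = ⊥-elim (𝕀≢0 refl)
  nonzero-× : nonzero x × hermAt c e x ≡ hermAt c e x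
  nonzero-× with x ≟ᵛ zeroWord
  ... | yes refl = cong (_⊗ conj (e · zeroWord)) (sym (·-zeroʳ c))
  ... | no  _    = identityʳ (hermAt c e x)

multiplicity : ∀ {n} → Point → Vec Point n → ℕ
multiplicity p xs = sum (map (λ x → 𝕀 (x ∼? p)) xs)

herm-by-multiplicities : ∀ {n} (c e : Point) (xs : Vec Point n) →
  ∑ (map (hermAt c e) xs) ≡ ∑ (map (λ p → multiplicity p xs × hermAt c e p) points)
herm-by-multiplicities c e xs = begin
  ∑ (map (hermAt c e) xs)
    ≡⟨ cong ∑ (map-cong (hermAt-by-points c e) xs) ⟨
  ∑ (map (λ x → ∑ (map (λ p → 𝕀 (x ∼? p) × hermAt c e p) points)) xs)
    ≡⟨ ∑-map-swap (λ x p → 𝕀 (x ∼? p) × hermAt c e p) xs points ⟩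
  ∑ (map (λ p → ∑ (map (λ x → 𝕀 (x ∼? p) × hermAt c e p) xs)) points)
    ≡⟨ cong ∑ (map-cong count points) ⟩
  ∑ (map (λ p → multiplicity p xs × hermAt c e p) points) ∎
  where
  open ≡-Reasoning
  count : ∀ p → ∑ (map (λ x → 𝕀 (x ∼? p) × hermAt c e p) xs) ≡ multiplicity p xs × hermAt c e p
  count p = ∑-map-×-const (λ x → 𝕀 (x ∼? p)) (λ _ → hermAt c e p) (hermAt c e p) (λ _ _ → refl) xs

uniform⇒self-orthogonal : ∀ {n} s (xs : Vec Point n) → All (λ p → multiplicity p xs ≡ s) points →
                          ∀ c e → ∑ (map (hermAt c e) xs) ≡ 𝟎
uniform⇒self-orthogonal s xs uniform c e = begin
  ∑ (map (hermAt c e) xs)                                  ≡⟨ herm-by-multiplicities c e xs ⟩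
  ∑ (map (λ p → multiplicity p xs × hermAt c e p) points)  ≡⟨ ∑-map-congᴬ (All.map (λ {p} → cong (_× hermAt c e p)) uniform) ⟩
  ∑ (map (λ p → s × hermAt c e p) points)                  ≡⟨ ∑-map-×ˡ s (hermAt c e) points ⟩
  s × ∑ (map (hermAt c e) points)                          ≡⟨ cong (s ×_) (simplex-self-orthogonal c e) ⟩
  s × 𝟎                                                    ≡⟨ ×-zeroʳ s ⟩
  𝟎                                                        ∎
  where open ≡-Reasoning

nonzeroCount : ∀ {n} → Vec Point n → ℕ
nonzeroCount xs = sum (map nonzero xs)

weight-sum : ∀ {n} (xs : Vec Point n) → sum (map (λ c → weight c xs) points) ≡ 16 * nonzeroCount xs
weight-sum xs = begin
  sum (map (λ c → weight c xs) points)                       ≡⟨ ℕ-Sum.∑-map-swap (λ c x → wt₁ (c · x)) points xs ⟩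
  sum (map (λ x → sum (map (λ c → wt₁ (c · x)) points)) xs)  ≡⟨ cong sum (map-cong simplex-weight′ xs) ⟩
  sum (map (λ x → 16 * nonzero x) xs)                        ≡⟨ sum-map-*ˡ 16 nonzero xs ⟩
  16 * nonzeroCount xs                                       ∎
  where
  open ≡-Reasoning
  simplex-weight′ : ∀ x → sum (map (λ c → wt₁ (c · x)) points) ≡ 16 * nonzero x
  simplex-weight′ x = trans (cong sum (map-cong (λ c → cong wt₁ (·-comm c x)) points)) (simplex-weight x)

pencil-weight-sum : ∀ {n} (xs : Vec Point n) →
  All (λ p → sum (map (λ c → orthogonal c p * weight c xs) points) + 4 * multiplicity p xs ≡ 4 * nonzeroCount xs) points
pencil-weight-sum xs = All.map (λ {p} → summed p) pencil-weight
  where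
  open ≡-Reasoning
  summed : ∀ p → (∀ x → sum (map (λ c → orthogonal c p * wt₁ (c · x)) points) + 4 * 𝕀 (x ∼? p) ≡ 4 * nonzero x) →
           sum (map (λ c → orthogonal c p * weight c xs) points) + 4 * multiplicity p xs ≡ 4 * nonzeroCount xs
  summed p pointwise = begin
    sum (map (λ c → orthogonal c p * weight c xs) points) + 4 * multiplicity p xs
      ≡⟨ cong₂ _+_ (cong sum (map-cong (λ c → sum-map-*ˡ (orthogonal c p) (λ x → wt₁ (c · x)) xs) points))
                   (sum-map-*ˡ 4 (λ x → 𝕀 (x ∼? p)) xs) ⟨
    sum (map (λ c → sum (map (λ x → orthogonal c p * wt₁ (c · x)) xs)) points) + sum (map (λ x → 4 * 𝕀 (x ∼? p)) xs)
      ≡⟨ cong (_+ sum (map (λ x → 4 * 𝕀 (x ∼? p)) xs)) (ℕ-Sum.∑-map-swap (λ c x → orthogonal c p * wt₁ (c · x)) points xs) ⟩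
    sum (map (λ x → sum (map (λ c → orthogonal c p * wt₁ (c · x)) points)) xs) + sum (map (λ x → 4 * 𝕀 (x ∼? p)) xs)
      ≡⟨ ℕ-Sum.∑-map-∙ (λ x → sum (map (λ c → orthogonal c p * wt₁ (c · x)) points)) (λ x → 4 * 𝕀 (x ∼? p)) xs ⟨
    sum (map (λ x → sum (map (λ c → orthogonal c p * wt₁ (c · x)) points) + 4 * 𝕀 (x ∼? p)) xs)
      ≡⟨ cong sum (map-cong pointwise xs) ⟩
    sum (map (λ x → 4 * nonzero x) xs)
      ≡⟨ sum-map-*ˡ 4 nonzero xs ⟩
    4 * nonzeroCount xs ∎

heavy⇒constant-weight : ∀ s (xs : Vec Point (21 * s)) → All (λ c → 16 * s ≤ weight c xs) points →
  All (λ c → weight c xs ≡ 16 * s) points ∧ nonzeroCount xs ≡ 21 * s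
heavy⇒constant-weight s xs heavy = map⁻ (sum-≤⇒all-≡ heavy′ Σ≤) , ≤-antisym N≤ N≥
  where
  open ≤-Reasoning
  heavy′ : All (16 * s ≤_) (map (λ c → weight c xs) points)
  heavy′ = map⁺ heavy
  N≤ : nonzeroCount xs ≤ 21 * s
  N≤ = sum-map-≤1 (λ x → 𝕀≤1 (¬? (x ≟ᵛ zeroWord))) xs
  commute : 16 * (21 * s) ≡ 21 * (16 * s)
  commute = trans (sym (*-assoc 16 21 s)) (*-assoc 21 16 s)
  Σ≤ : sum (map (λ c → weight c xs) points) ≤ 21 * (16 * s)
  Σ≤ = begin
    sum (map (λ c → weight c xs) points)  ≡⟨ weight-sum xs ⟩
    16 * nonzeroCount xs                  ≤⟨ *-monoʳ-≤ 16 N≤ ⟩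
    16 * (21 * s)                         ≡⟨ commute ⟩
    21 * (16 * s)                         ∎
  N≥ : 21 * s ≤ nonzeroCount xs
  N≥ = *-cancelˡ-≤ 16 (begin
    16 * (21 * s)                         ≡⟨ commute ⟩
    21 * (16 * s)                         ≤⟨ sum-≥ heavy′ ⟩
    sum (map (λ c → weight c xs) points)  ≡⟨ weight-sum xs ⟩
    16 * nonzeroCount xs                  ∎)

pencil-arithmetic : ∀ s m → 5 * (16 * s) + 4 * m ≡ 4 * (21 * s) → m ≡ s
pencil-arithmetic s m eq = *-cancelˡ-≡ m s 4 (+-cancelˡ-≡ (4 * (20 * s)) (4 * m) (4 * s) (begin
  4 * (20 * s) + 4 * m   ≡⟨ cong (_+ 4 * m) (trans (sym (*-assoc 4 20 s)) (*-assoc 5 16 s)) ⟩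
  5 * (16 * s) + 4 * m   ≡⟨ eq ⟩
  4 * (s + 20 * s)       ≡⟨ *-distribˡ-+ 4 s (20 * s) ⟩
  4 * s + 4 * (20 * s)   ≡⟨ +-comm (4 * s) (4 * (20 * s)) ⟩
  4 * (20 * s) + 4 * s   ∎))
  where open ≡-Reasoning

heavy⇒uniform : ∀ s (xs : Vec Point (21 * s)) → All (λ c → 16 * s ≤ weight c xs) points →
                All (λ p → multiplicity p xs ≡ s) points
heavy⇒uniform s xs heavy = All.map (λ {p} → multiplicity≡s p) (All.zip (pencil-weight-sum xs , pencil-size))
  where
  open ≡-Reasoning
  constant : All (λ c → weight c xs ≡ 16 * s) points ∧ nonzeroCount xs ≡ 21 * s
  constant = heavy⇒constant-weight s xs heavy
  multiplicity≡s : ∀ p →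
    sum (map (λ c → orthogonal c p * weight c xs) points) + 4 * multiplicity p xs ≡ 4 * nonzeroCount xs ∧
    sum (map (λ c → orthogonal c p) points) ≡ 5 → multiplicity p xs ≡ s
  multiplicity≡s p (pencil-sum , pencil-size) = pencil-arithmetic s (multiplicity p xs) (begin
    5 * (16 * s) + 4 * multiplicity p xs
      ≡⟨ cong (λ k → k * (16 * s) + 4 * multiplicity p xs) pencil-size ⟨
    sum (map (λ c → orthogonal c p) points) * (16 * s) + 4 * multiplicity p xs
      ≡⟨ cong (_+ 4 * multiplicity p xs) (sum-map-*ʳ (16 * s) (λ c → orthogonal c p) points) ⟨
    sum (map (λ c → orthogonal c p * (16 * s)) points) + 4 * multiplicity p xs
      ≡⟨ cong (_+ 4 * multiplicity p xs) (ℕ-Sum.∑-map-congᴬ (All.map (λ {c} → cong (orthogonal c p *_)) (proj₁ constant))) ⟨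
    sum (map (λ c → orthogonal c p * weight c xs) points) + 4 * multiplicity p xs
      ≡⟨ pencil-sum ⟩
    4 * nonzeroCount xs
      ≡⟨ cong (4 *_) (proj₂ constant) ⟩
    4 * (21 * s) ∎)

upper-bound : ∀ s (G : Gen (21 * s) 3) → Independent G → HermLCD G → ∀ d → MinWeight G d → d ≤ 16 * s ∸ 1
upper-bound s G independent lcd d (_ , d≤wt) with 16 * s ≤? d
... | no  16s≰d = subst (d ≤_) (pred[m∸n]≡m∸[1+n] (16 * s) 0) (<⇒≤pred (≰⇒> 16s≰d))
... | yes 16s≤d = ⊥-elim (e₁≢0 (independent e₁ (lcd (lincomb e₁ G) (e₁ , refl) e₁-orthogonal)))
  where
  e₁ : Point
  e₁ = 𝟏 ∷ 𝟎 ∷ 𝟎 ∷ []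
  e₁≢0 : e₁ ≢ zeroWord
  e₁≢0 ()
  heavy : All (λ c → 16 * s ≤ weight c (transpose G)) points
  heavy = All.map (λ {c} c≢0 → ≤-trans 16s≤d (subst (d ≤_) (wt-lincomb c G)
                     (d≤wt (lincomb c G) (c , refl) (c≢0 ∘ independent c))))
                  points-nonzero
  e₁-orthogonal : ∀ y → y ∈C G → herm (lincomb e₁ G) y ≡ 𝟎
  e₁-orthogonal _ (e , refl) = trans (herm-lincomb e₁ e G)
    (uniform⇒self-orthogonal s (transpose G) (heavy⇒uniform s (transpose G) heavy) e₁ e)

-- The simplex code with the columns (1,1,ω) and (1,ω,0) replaced by
-- (1,ω,ω) and (1,ω,ω²): a Hermitian LCD [21,3,15] code.
base : Vec Point 21
base =
  (𝟎 ∷ 𝟎 ∷ 𝟏 ∷ []) ∷ (𝟎 ∷ 𝟏 ∷ 𝟎 ∷ []) ∷ (𝟎 ∷ 𝟏 ∷ 𝟏 ∷ []) ∷ (𝟎 ∷ 𝟏 ∷ ω ∷ []) ∷ (𝟎 ∷ 𝟏 ∷ ω² ∷ []) ∷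
  (𝟏 ∷ 𝟎 ∷ 𝟎 ∷ []) ∷ (𝟏 ∷ 𝟎 ∷ 𝟏 ∷ []) ∷ (𝟏 ∷ 𝟎 ∷ ω ∷ []) ∷ (𝟏 ∷ 𝟎 ∷ ω² ∷ []) ∷
  (𝟏 ∷ 𝟏 ∷ 𝟎 ∷ []) ∷ (𝟏 ∷ 𝟏 ∷ 𝟏 ∷ []) ∷ (𝟏 ∷ ω ∷ ω ∷ []) ∷ (𝟏 ∷ 𝟏 ∷ ω² ∷ []) ∷
  (𝟏 ∷ ω ∷ ω² ∷ []) ∷ (𝟏 ∷ ω ∷ 𝟏 ∷ []) ∷ (𝟏 ∷ ω ∷ ω ∷ []) ∷ (𝟏 ∷ ω ∷ ω² ∷ []) ∷
  (𝟏 ∷ ω² ∷ 𝟎 ∷ []) ∷ (𝟏 ∷ ω² ∷ 𝟏 ∷ []) ∷ (𝟏 ∷ ω² ∷ ω ∷ []) ∷ (𝟏 ∷ ω² ∷ ω² ∷ []) ∷ []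

base-weight : ∀ c → c ≢ zeroWord → 15 ≤ weight c base
base-weight = from-yes (universalᵛ? λ c → ¬? (c ≟ᵛ zeroWord) →-dec 15 ℕ.≤? weight c base)

base-LCD : ∀ c → (∀ e → ∑ (map (hermAt c e) base) ≡ 𝟎) → c ≡ zeroWord
base-LCD = from-yes (universalᵛ? λ c → universalᵛ? (λ e → ∑ (map (hermAt c e) base) ≟ 𝟎) →-dec c ≟ᵛ zeroWord)

15+16t≡16[1+t]∸1 : ∀ t → 15 + t * 16 ≡ 16 * suc t ∸ 1
15+16t≡16[1+t]∸1 t = 15+16t≡t+15[1+t] t
  where
  15+16t≡t+15[1+t] : ∀ t → 15 + t * 16 ≡ t + 15 * suc t
  15+16t≡t+15[1+t] = solve-∀

module Construction (t : ℕ) where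

  code : Gen (21 * suc t) 3
  code = transpose (juxtapose t base points)

  code-weight : ∀ c → c ≢ zeroWord → wt (lincomb c code) ≡ weight c base + t * 16
  code-weight c c≢0 = begin
    wt (lincomb c code)                        ≡⟨ wt-lincomb c code ⟩
    weight c (transpose code)                  ≡⟨ cong (weight c) (transpose-involutive (juxtapose t base points)) ⟩
    weight c (juxtapose t base points)         ≡⟨ ℕ-Sum.∑-map-juxtapose (λ x → wt₁ (c · x)) t base points ⟩
    weight c base + t ℕ-Sum.× weight c points  ≡⟨ cong (λ w → weight c base + t ℕ-Sum.× w) simplex-16 ⟩
    weight c base + t ℕ-Sum.× 16               ≡⟨ cong (weight c base +_) (×≡* t 16) ⟩
    weight c base + t * 16                     ∎
    where
    open ≡-Reasoning
    simplex-16 : weight c points ≡ 16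
    simplex-16 = trans (simplex-weight c) (cong (16 *_) (nonzero-≢ c≢0))

  code-herm : ∀ c e → herm (lincomb c code) (lincomb e code) ≡ ∑ (map (hermAt c e) base)
  code-herm c e = begin
    herm (lincomb c code) (lincomb e code)
      ≡⟨ herm-lincomb c e code ⟩
    ∑ (map (hermAt c e) (transpose code))
      ≡⟨ cong (∑ ∘ map (hermAt c e)) (transpose-involutive (juxtapose t base points)) ⟩
    ∑ (map (hermAt c e) (juxtapose t base points))
      ≡⟨ ∑-map-juxtapose (hermAt c e) t base points ⟩
    ∑ (map (hermAt c e) base) ⊕ t × ∑ (map (hermAt c e) points)
      ≡⟨ cong (λ h → ∑ (map (hermAt c e) base) ⊕ t × h) (simplex-self-orthogonal c e) ⟩
    ∑ (map (hermAt c e) base) ⊕ t × 𝟎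
      ≡⟨ cong (∑ (map (hermAt c e) base) ⊕_) (×-zeroʳ t) ⟩
    ∑ (map (hermAt c e) base) ⊕ 𝟎
      ≡⟨ identityʳ _ ⟩
    ∑ (map (hermAt c e) base) ∎
    where open ≡-Reasoning

  code-heavy : ∀ c → c ≢ zeroWord → 16 * suc t ∸ 1 ≤ wt (lincomb c code)
  code-heavy c c≢0 =
    subst₂ _≤_ (15+16t≡16[1+t]∸1 t) (sym (code-weight c c≢0)) (+-monoˡ-≤ (t * 16) (base-weight c c≢0))

  code-nonzero : ∀ c → c ≢ zeroWord → lincomb c code ≢ zeroWord
  code-nonzero c c≢0 cG≡0 = 1+n≰n (begin
    1                           ≤⟨ s≤s z≤n ⟩
    15 + t * 16                 ≤⟨ +-monoˡ-≤ (t * 16) (base-weight c c≢0) ⟩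
    weight c base + t * 16      ≡⟨ code-weight c c≢0 ⟨
    wt (lincomb c code)         ≡⟨ cong wt cG≡0 ⟩
    wt (zeroWord {21 * suc t})  ≡⟨ wt-zeroWord (21 * suc t) ⟩
    0                           ∎)
    where open ≤-Reasoning

  code-independent : Independent code
  code-independent c cG≡0 with c ≟ᵛ zeroWord
  ... | yes c≡0 = c≡0
  ... | no  c≢0 = ⊥-elim (code-nonzero c c≢0 cG≡0)

  code-LCD : HermLCD code
  code-LCD _ (c , refl) cG⊥C =
    trans (cong (λ c → lincomb c code) (base-LCD c λ e → trans (sym (code-herm c e)) (cG⊥C _ (e , refl))))
          (lincomb-zero code)

  code-minWeight : MinWeight code (16 * suc t ∸ 1)
  code-minWeight =
    (lincomb c₀ code , (c₀ , refl) , code-nonzero c₀ (λ ()) , trans (code-weight c₀ (λ ())) (15+16t≡16[1+t]∸1 t)) ,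
    λ { _ (c , refl) cG≢0 → code-heavy c λ c≡0 →
          cG≢0 (trans (cong (λ c → lincomb c code) c≡0) (lincomb-zero code)) }
    where
    c₀ : Point
    c₀ = 𝟎 ∷ 𝟏 ∷ 𝟏 ∷ []

proposition5p6 : ∀ (s : ℕ) → 1 ≤ s → D4 (21 * s) 3 (16 * s ∸ 1)
proposition5p6 (suc t) _ = (code , code-independent , code-LCD , code-minWeight) , upper-bound (suc t)
  where open Construction t
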